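{- Not all cobweb-admissible sequences are cobweb tiling sequences; that is, there exists a cobweb-admissible sequence $F=\{n_F\}_{n\ge 0}$ and integers $0\le k<n$ such that the layer $\langle \Phi_{k+1}\to\Phi_n\rangle$ of the cobweb poset of $F$ admits no partition into max-disjoint blocks of the form $\sigma P_m$, $m=n-k$.
   Context: Let $F=\{n_F\}_{n\ge0}$ be a sequence of positive integers with $0_F=1$. Define $n_F!=1_F\cdot 2_F\cdots n_F$ ($0_F!=1$), $n_F^{\underline{k}}=n_F(n-1)_F\cdots(n-k+1)_F$, and the $F$-nomial coefficients $\binom{n}{k}_F=\frac{n_F^{\underline{k}}}{k_F!}$. The sequence $F$ is called cobweb-admissible if $\binom{n}{k}_F$ is a nonnegative integer for all integers $n,k\ge0$ (with $\binom{n}{k}_F=0$ for $k>n$). The cobweb poset of $F$ is the graded poset whose vertex set is a disjoint union of levels $\Phi_s$, $s\ge 0$, with $|\Phi_s|=s_F$, and in which $x<y$ whenever $x\in\Phi_r$, $y\in\Phi_s$ with $r<s$ (so every vertex of $\Phi_s$ is covered by every vertex of $\Phi_{s+1}$). For $k<n$ the layer $\langle\Phi_{k+1}\to\Phi_n\rangle$ is the subposet on $\Phi_{k+1}\cup\dots\cup\Phi_n$; its maximal chains are the tuples $(x_{k+1},\dots,x_n)$ with $x_s\in\Phi_s$. With $m=n-k$, a block of the form $\sigma P_m$ in this layer is a subposet on $V_{k+1}\cup\dots\cup V_n$ with $V_s\subseteq\Phi_s$ such that $(|V_{k+1}|,\dots,|V_n|)$ is a permutation $\sigma$ of $(1_F,2_F,\dots,m_F)$;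 its set of maximal chains is $V_{k+1}\times\dots\times V_n$. Two blocks are max-disjoint if they have no maximal chain in common. A partition (tiling) of the layer by max-disjoint blocks $\sigma P_m$ is a family of such blocks whose sets of maximal chains partition the set of all maximal chains of the layer. A cobweb-admissible sequence is a cobweb tiling sequence if every layer $\langle\Phi_{k+1}\to\Phi_n\rangle$, $0\le k<n$, of its cobweb poset admits such a partition. -}

module Defs where

open import Data.Nat using (ℕ; zero; suc; _+_; _*_; _∸_; _<_; _≤_)
open import Data.Nat.Divisibility using (_∣_)
open import Data.Fin using (Fin; toℕ)
open import Data.Fin.Subset using (Subset; _∈_; ∣_∣)
open import Data.Fin.Permutation using (Permutation′; _⟨$⟩ʳ_)
open import Data.Product using (Σ; ∃; ∃-syntax; _×_)
open import Relation.Binary.PropositionalEquality using (_≡_)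

Seq : Set
Seq = ℕ → ℕ

fact : Seq → ℕ → ℕ
fact F zero    = 1
fact F (suc n) = fact F n * F (suc n)

falling : Seq → ℕ → ℕ → ℕ
falling F n zero    = 1
falling F n (suc k) = F n * falling F (n ∸ 1) k

IsFSeq : Seq → Set
IsFSeq F = (F 0 ≡ 1) × (∀ n → 0 < F n)

-- cobweb-admissible: every F-nomial n_F^{\underline k} / k_F! is a
-- (nonnegative) integer, i.e. k_F! divides n_F^{\underline k} for k ≤ n
-- (for k > n the coefficient is 0 by convention, no constraint).
CobwebAdmissible : Seq → Set
CobwebAdmissible F = IsFSeq F × (∀ n k → k ≤ n → fact F k ∣ falling F n k)

-- Level Φ_s of the cobweb poset is (a copy of) Fin (F s).
-- In the layer ⟨Φ_{k+1} → Φ_n⟩ with m = n - k, position i : Fin m is the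
-- level s = k + 1 + i.
level : Seq → ℕ → {m : ℕ} → Fin m → ℕ
level F k i = suc (k + toℕ i)

MaxChain : Seq → ℕ → ℕ → Set
MaxChain F k m = (i : Fin m) → Fin (F (level F k i))

-- a block σP_m: subsets V_s ⊆ Φ_s whose sizes form a permutation σ of
-- (1_F, …, m_F), i.e. |V_{k+1+i}| = (σ(i)+1)_F.
record Block (F : Seq) (k m : ℕ) : Set where
  field
    V    : (i : Fin m) → Subset (F (level F k i))
    σ    : Permutation′ m
    size : ∀ i → ∣ V i ∣ ≡ F (suc (toℕ (σ ⟨$⟩ʳ i)))

_∈Block_ : {F : Seq} {k m : ℕ} → MaxChain F k m → Block F k m → Set
c ∈Block B = ∀ i → c i ∈ Block.V B i

-- a partition of the layer by max-disjoint blocks: a (finite) family of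
-- blocks whose sets of maximal chains partition all maximal chains.
Tiling : Seq → ℕ → ℕ → Set
Tiling F k m =
  Σ ℕ λ t → Σ (Fin t → Block F k m) λ B →
    (∀ (c : MaxChain F k m) → ∃[ j ] (c ∈Block B j))
    × (∀ (c : MaxChain F k m) j j' → c ∈Block B j → c ∈Block B j' → j ≡ j')

LayerTileable : Seq → ℕ → ℕ → Set
LayerTileable F k n = Tiling F k (n ∸ k)

CobwebTiling : Seq → Set
CobwebTiling F = CobwebAdmissible F × (∀ k n → k < n → LayerTileable F k n)

-- The sequence 1, 1, 4, 2, 2, 2, … is cobweb-admissible: from index 2 on every
-- term is even, so a falling factorial of length k < n is divisible by 2^k,
-- while k_F! divides 2^k. Yet the layer ⟨Φ₃ → Φ₄⟩ has only levels of size 2,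
-- whereas every block σP₂ must contain a level of size 2_F = 4; since the layer
-- has maximal chains, a tiling would need at least one block, which cannot exist.
module Submission where

open import Defs
open import Data.Nat using (ℕ; zero; suc; _+_; _*_; _∸_; _^_; _<_; _≤_; z≤n; s≤s)
open import Data.Nat.Properties
  using (*-comm; +-suc; ≤-pred; ≤⇒≯; m≤n⇒m≤1+n; m+n≤o⇒m≤o; m≤n⇒m<n∨m≡n)
open import Data.Nat.Divisibility using (_∣_; divides; ∣-refl; ∣-trans; ∣-reflexive; *-pres-∣; 1∣_)
open import Data.Fin using (Fin; toℕ; fromℕ<) renaming (zero to fzero; suc to fsuc)
open import Data.Fin.Subset using (∣_∣)
open import Data.Fin.Subset.Properties using (∣p∣≤n)
open import Data.Fin.Permutation using (_⟨$⟩ˡ_; inverseʳ)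
open import Data.Product using (Σ; _×_; _,_; proj₁)
open import Data.Sum using (inj₁; inj₂)
open import Relation.Nullary using (¬_)
open import Relation.Binary.PropositionalEquality using (_≡_; refl; sym; trans; cong; subst)
open import Relation.Binary.PropositionalEquality.Properties using (module ≡-Reasoning)

falling-self≡fact : ∀ F n → falling F n n ≡ fact F n
falling-self≡fact F zero    = refl
falling-self≡fact F (suc n) = begin
  F (suc n) * falling F n n ≡⟨ cong (F (suc n) *_) (falling-self≡fact F n) ⟩
  F (suc n) * fact F n      ≡⟨ *-comm (F (suc n)) (fact F n) ⟩
  fact F n * F (suc n)      ∎
  where open ≡-Reasoning

-- The k factors of falling F n k have indices n, n-1, …, n-k+1, all ≥ a.
pow-∣-falling : ∀ {F d} a → (∀ i → a ≤ i → d ∣ F i) →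
                ∀ n k → a + k ≤ suc n → d ^ k ∣ falling F n k
pow-∣-falling a d∣F n zero _ = ∣-refl
pow-∣-falling a d∣F n (suc k) a+k<1+n rewrite +-suc a k =
  *-pres-∣ (d∣F n (m+n≤o⇒m≤o a a+k≤n)) (pow-∣-falling a d∣F (n ∸ 1) k (shift n a+k≤n))
  where
  a+k≤n : a + k ≤ n
  a+k≤n = ≤-pred a+k<1+n
  shift : ∀ n → a + k ≤ n → a + k ≤ suc (n ∸ 1)
  shift zero    p = m≤n⇒m≤1+n p
  shift (suc n) p = p

no-block-if-oversized : ∀ {F k m} (v : Fin m) →
                        (∀ i → F (level F k i) < F (suc (toℕ v))) → ¬ Block F k m
no-block-if-oversized {F} {k} {m} v small B =
  ≤⇒≯ (∣p∣≤n (V i)) (subst (F (level F k i) <_) (sym realised) (small i))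
  where
  open Block B
  i : Fin m
  i = σ ⟨$⟩ˡ v
  realised : ∣ V i ∣ ≡ F (suc (toℕ v))
  realised = trans (size i) (cong (λ w → F (suc (toℕ w))) (inverseʳ σ))

tiling⇒block : ∀ {F k m} → IsFSeq F → Tiling F k m → Block F k m
tiling⇒block (_ , positive) (_ , B , covers , _) with covers (λ i → fromℕ< (positive _))
... | j , _ = B j

G : Seq
G 0 = 1
G 1 = 1
G 2 = 4
G (suc (suc (suc n))) = 2

G-even : ∀ i → 2 ≤ i → 2 ∣ G i
G-even (suc zero)          (s≤s ())
G-even (suc (suc zero))    _ = divides 2 refl
G-even (suc (suc (suc i))) _ = ∣-refl

fact-G-∣-2^ : ∀ k → fact G k ∣ 2 ^ k
fact-G-∣-2^ zero          = ∣-refl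
fact-G-∣-2^ (suc zero)    = 1∣ 2
fact-G-∣-2^ (suc (suc k)) = ∣-reflexive (fact-G-suc-suc k)
  where
  fact-G-suc-suc : ∀ k → fact G (2 + k) ≡ 2 ^ (2 + k)
  fact-G-suc-suc zero    = refl
  fact-G-suc-suc (suc k) = trans (cong (_* 2) (fact-G-suc-suc k)) (*-comm (2 ^ (2 + k)) 2)

G-admissible : CobwebAdmissible G
G-admissible = ((refl , positive) , fact-∣-falling)
  where
  positive : ∀ n → 0 < G n
  positive 0                   = s≤s z≤n
  positive 1                   = s≤s z≤n
  positive 2                   = s≤s z≤n
  positive (suc (suc (suc n))) = s≤s z≤n
  fact-∣-falling : ∀ n k → k ≤ n → fact G k ∣ falling G n k
  fact-∣-falling n k k≤n with m≤n⇒m<n∨m≡n k≤n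
  ... | inj₁ k<n  = ∣-trans (fact-G-∣-2^ k) (pow-∣-falling 2 G-even n k (s≤s k<n))
  ... | inj₂ refl = ∣-reflexive (sym (falling-self≡fact G k))

theorem3 : Σ Seq λ F → CobwebAdmissible F × Σ ℕ λ k → Σ ℕ λ n →
             (k < n) × ¬ LayerTileable F k n
theorem3 = G , G-admissible , 2 , 4 , s≤s (s≤s (s≤s z≤n)) ,
           λ tiling → no-block-if-oversized (fsuc fzero) (λ _ → s≤s (s≤s (s≤s z≤n)))
                        (tiling⇒block (proj₁ G-admissible) tiling)
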